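{- Let $G=(V,E)$ be a finite simple graph in which every vertex has degree $\Delta$ or $\Delta-1$, and suppose $G$ has exactly $k$ vertices of degree $\Delta-1$, all of which are separation vertices. If $|V|\ge \Delta+\Delta^2+\Delta^3+2$, then there exists a graph $H$ on $|V|$ vertices which is a disjoint union of regular graphs such that $d(G,H)\le k+4\Delta$.
   Context: A vertex $v$ of a graph is a separation vertex if it has a neighbor $w$ with $\deg(w)>\deg(v)$. A "disjoint union of regular graphs" (component-wise regular graph) means a graph every connected component of which is regular (different components may have different degrees). For two graphs $G,H$ on the same number $n$ of vertices, $d(G,H)=\frac12\min_{\pi\in S_n}\sum_{i,j=1}^n |A(G)_{i,j}-A(H)_{\pi(i),\pi(j)}|$, where $A(\cdot)$ is the adjacency matrix; equivalently, the minimal number of edge additions/removals turning $G$ into a graph isomorphic to $H$. -}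

module Defs where

open import Data.Nat using (ℕ; suc; _+_; _*_; _≤_; _<_; _≟_)
open import Data.Bool using (Bool; true; false; if_then_else_; _xor_)
open import Data.Fin using (Fin)
open import Data.List using (List; map; length; filter; allFin)
open import Data.Nat.ListAction using (sum)
open import Data.Product using (Σ; _×_)
open import Data.Fin.Permutation using (Permutation′; _⟨$⟩ʳ_)
open import Relation.Binary.PropositionalEquality using (_≡_)

record Graph (n : ℕ) : Set where
  field
    adj    : Fin n → Fin n → Bool
    sym    : ∀ i j → adj i j ≡ adj j i
    irrefl : ∀ i → adj i i ≡ false
open Graph public

Σᵥ : {n : ℕ} → (Fin n → ℕ) → ℕ
Σᵥ {n} f = sum (map f (allFin n))

ind : Bool → ℕ
ind b = if b then 1 else 0

deg : {n : ℕ} → Graph n → Fin n → ℕ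
deg G v = Σᵥ (λ w → ind (adj G v w))

IsSeparationVertex : {n : ℕ} → Graph n → Fin n → Set
IsSeparationVertex G v = Σ (Fin _) λ w → (adj G v w ≡ true) × (deg G v < deg G w)

numDegPred : {n : ℕ} → Graph n → ℕ → ℕ
numDegPred {n} G Δ = length (filter (λ v → suc (deg G v) ≟ Δ) (allFin n))

data Reach {n : ℕ} (G : Graph n) : Fin n → Fin n → Set where
  here : ∀ {u} → Reach G u u
  step : ∀ {u w v} → adj G u w ≡ true → Reach G w v → Reach G u v

-- every connected component is regular (disjoint union of regular graphs)
ComponentwiseRegular : {n : ℕ} → Graph n → Set
ComponentwiseRegular G = ∀ u v → Reach G u v → deg G u ≡ deg G v

diffSum : {n : ℕ} → Graph n → Graph n → Permutation′ n → ℕ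
diffSum G H π = Σᵥ (λ i → Σᵥ (λ j → ind (adj G i j xor adj H (π ⟨$⟩ʳ i) (π ⟨$⟩ʳ j))))

-- d(G,H) ≤ m, where d(G,H) = (1/2) min_π diffSum G H π
DistLE : {n : ℕ} → Graph n → Graph n → ℕ → Set
DistLE G H m = Σ (Permutation′ _) λ π → diffSum G H π ≤ 2 * m

{-# OPTIONS --safe #-}
-- Call a vertex deficient when its degree is Δ − 1, and repair deficient
-- vertices two at a time.  If some pair u, v is non-adjacent, add the edge uv.
-- Otherwise every deficient vertex lies in the closed neighbourhood N[u], so
-- there are at most Δ of them; double counting edges (using n ≥ 2Δ + 3) gives
-- an edge xy with x ∉ N[u] and y ∉ N[v], and replacing xy by ux and vy raises
-- exactly u and v.  Repairing k deficient vertices so costs at most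
-- k + min(k, Δ) edge edits and leaves a Δ-regular graph or a single deficient
-- vertex u.  In the latter case nΔ = 2|E| + 1 is odd.  Delete the Δ − 1 edges
-- at u and repair again, keeping u isolated: ending with one deficient vertex
-- would now give nΔ = 2|E′| + 1 + Δ, forcing Δ to be even, so the result has
-- only Δ-regular components and the isolated vertex u, within k + 4Δ edits.
module Submission where

open import Defs hiding (sym)
import Algebra.Properties.Semiring.Sum
open import Data.Bool using (Bool; true; false; not; _∧_; _∨_; _xor_; if_then_else_)
import Data.Bool as Bool
open import Data.Bool.Properties
  using (∧-comm; ∧-identityʳ; ∧-zeroʳ; ∧-conicalˡ; ∧-conicalʳ; ∨-comm; ∨-zeroʳ; ∨-identityʳ; ∨-conicalˡ;
         ∨-conicalʳ; not-injective; xor-identityʳ; xor-assoc; xor-same; xor-comm; true-xor)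
open import Data.Empty using (⊥; ⊥-elim)
open import Data.Fin using (Fin; zero; suc; _≟_; punchIn; punchOut)
import Data.Fin.Permutation as Perm
open import Data.Fin.Properties using (any?; punchInᵢ≢i; punchIn-punchOut)
import Data.Fin.Properties as Finₚ
open import Data.List using ([]; _∷_; map; length; filter; allFin)
open import Data.List.Properties using (map-tabulate; map-cong)
open import Data.Nat using (ℕ; zero; suc; _+_; _*_; _∸_; _^_; _⊓_; _≤_; _<_; _<?_; z≤n; s≤s)
import Data.Nat as ℕ
open import Data.Nat.ListAction using (sum)
open import Data.Nat.Properties hiding (_≟_)
open import Algebra.Properties.CommutativeSemigroup +-commutativeSemigroup using (xy∙z≈zy∙x; xy∙z≈xz∙y)
open import Data.Nat.Tactic.RingSolver using (solve-∀)
open import Data.Product using (Σ; ∃; _×_; _,_; proj₁; proj₂)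
open import Data.Sum using (_⊎_; inj₁; inj₂)
open import Data.Vec.Functional using (removeAt)
open import Function using (id; _∘_)
open import Level using (0ℓ)
open import Relation.Binary.Definitions using (tri<; tri≈; tri>)
open import Relation.Binary.PropositionalEquality
open import Relation.Nullary using (Dec; yes; no; does; ¬?; _×-dec_; contradiction)
open import Relation.Nullary.Decidable using (dec-true; dec-false)
open import Relation.Unary using (Pred; Decidable)

module ∑ = Algebra.Properties.Semiring.Sum +-*-semiring

-- Sums over the vertex set

Σᵥ-suc : ∀ {n} (f : Fin (suc n) → ℕ) → Σᵥ f ≡ f zero + Σᵥ (f ∘ suc)
Σᵥ-suc f = cong (λ xs → f zero + sum xs) (trans (map-tabulate suc f) (sym (map-tabulate id (f ∘ suc))))

Σᵥ≡∑ : ∀ {n} (f : Fin n → ℕ) → Σᵥ f ≡ ∑.sum f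
Σᵥ≡∑ {zero}  f = refl
Σᵥ≡∑ {suc n} f = trans (Σᵥ-suc f) (cong (f zero +_) (Σᵥ≡∑ (f ∘ suc)))

Σᵥ-cong : ∀ {n} {f g : Fin n → ℕ} → f ≗ g → Σᵥ f ≡ Σᵥ g
Σᵥ-cong {n} f≗g = cong sum (map-cong f≗g (allFin n))

Σᵥ-mono : ∀ {n} {f g : Fin n → ℕ} → (∀ i → f i ≤ g i) → Σᵥ f ≤ Σᵥ g
Σᵥ-mono {zero}          f≤g = z≤n
Σᵥ-mono {suc n} {f} {g} f≤g rewrite Σᵥ-suc f | Σᵥ-suc g =
  +-mono-≤ (f≤g zero) (Σᵥ-mono (f≤g ∘ suc))

Σᵥ-const : ∀ {n} c → Σᵥ {n} (λ _ → c) ≡ n * c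
Σᵥ-const {zero}  c = refl
Σᵥ-const {suc n} c = trans (Σᵥ-suc {n} (λ _ → c)) (cong (c +_) (Σᵥ-const {n} c))

Σᵥ-zero : ∀ {n} → Σᵥ {n} (λ _ → 0) ≡ 0
Σᵥ-zero {n} = trans (Σᵥ-const {n} 0) (*-zeroʳ n)

Σᵥ-distrib-+ : ∀ {n} (f g : Fin n → ℕ) → Σᵥ (λ i → f i + g i) ≡ Σᵥ f + Σᵥ g
Σᵥ-distrib-+ f g = begin
  Σᵥ (λ i → f i + g i)     ≡⟨ Σᵥ≡∑ (λ i → f i + g i) ⟩
  ∑.sum (λ i → f i + g i)  ≡⟨ ∑.∑-distrib-+ f g ⟩
  ∑.sum f + ∑.sum g        ≡⟨ cong₂ _+_ (Σᵥ≡∑ f) (Σᵥ≡∑ g) ⟨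
  Σᵥ f + Σᵥ g              ∎
  where open ≡-Reasoning

*-distribˡ-Σᵥ : ∀ {n} c (f : Fin n → ℕ) → c * Σᵥ f ≡ Σᵥ (λ i → c * f i)
*-distribˡ-Σᵥ c f = begin
  c * Σᵥ f               ≡⟨ cong (c *_) (Σᵥ≡∑ f) ⟩
  c * ∑.sum f            ≡⟨ ∑.*-distribˡ-sum c f ⟩
  ∑.sum (λ i → c * f i)  ≡⟨ Σᵥ≡∑ (λ i → c * f i) ⟨
  Σᵥ (λ i → c * f i)     ∎
  where open ≡-Reasoning

Σᵥ-comm : ∀ {m n} (f : Fin m → Fin n → ℕ) → Σᵥ (λ i → Σᵥ (f i)) ≡ Σᵥ (λ j → Σᵥ (λ i → f i j))
Σᵥ-comm f = begin
  Σᵥ (λ i → Σᵥ (f i))                ≡⟨ Σᵥ²≡∑² f ⟩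
  ∑.sum (λ i → ∑.sum (f i))          ≡⟨ ∑.∑-comm f ⟩
  ∑.sum (λ j → ∑.sum (λ i → f i j))  ≡⟨ Σᵥ²≡∑² (λ j i → f i j) ⟨
  Σᵥ (λ j → Σᵥ (λ i → f i j))        ∎
  where
  open ≡-Reasoning
  Σᵥ²≡∑² : ∀ {m n} (g : Fin m → Fin n → ℕ) → Σᵥ (λ i → Σᵥ (g i)) ≡ ∑.sum (λ i → ∑.sum (g i))
  Σᵥ²≡∑² g = trans (Σᵥ≡∑ (λ i → Σᵥ (g i))) (∑.sum-cong-≗ (Σᵥ≡∑ ∘ g))

Σᵥ-removeAt : ∀ {n} (f : Fin (suc n) → ℕ) i → Σᵥ f ≡ f i + Σᵥ (removeAt f i)
Σᵥ-removeAt f i = trans (Σᵥ≡∑ f) (trans (∑.sum-remove f) (cong (f i +_) (sym (Σᵥ≡∑ (removeAt f i)))))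

Σᵥ-term : ∀ {n} (f : Fin n → ℕ) i → f i ≤ Σᵥ f
Σᵥ-term {suc n} f i = ≤-trans (m≤m+n (f i) _) (≤-reflexive (sym (Σᵥ-removeAt f i)))

Σᵥ-pair : ∀ {n} (f : Fin n → ℕ) {i j} → i ≢ j → f i + f j ≤ Σᵥ f
Σᵥ-pair {suc n} f {i} {j} i≢j = begin
  f i + f j                          ≡⟨ cong (λ k → f i + f k) (punchIn-punchOut i≢j) ⟨
  f i + removeAt f i (punchOut i≢j)  ≤⟨ +-monoʳ-≤ (f i) (Σᵥ-term (removeAt f i) (punchOut i≢j)) ⟩
  f i + Σᵥ (removeAt f i)            ≡⟨ Σᵥ-removeAt f i ⟨
  Σᵥ f                               ∎
  where open ≤-Reasoning

Σᵥ-update : ∀ {n} {f g : Fin n → ℕ} i → (∀ j → j ≢ i → f j ≡ g j) → Σᵥ f + g i ≡ Σᵥ g + f i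
Σᵥ-update {suc n} {f} {g} i f≡g = begin
  Σᵥ f + g i                     ≡⟨ cong (_+ g i) (Σᵥ-removeAt f i) ⟩
  f i + Σᵥ (removeAt f i) + g i  ≡⟨ cong (λ s → f i + s + g i) (Σᵥ-cong λ j → f≡g _ (punchInᵢ≢i i j)) ⟩
  f i + Σᵥ (removeAt g i) + g i  ≡⟨ xy∙z≈zy∙x (f i) _ (g i) ⟩
  g i + Σᵥ (removeAt g i) + f i  ≡⟨ cong (_+ f i) (Σᵥ-removeAt g i) ⟨
  Σᵥ g + f i                     ∎
  where open ≡-Reasoning

Σᵥ-single : ∀ {n} (f : Fin n → ℕ) i → (∀ j → j ≢ i → f j ≡ 0) → Σᵥ f ≡ f i
Σᵥ-single {n} f i vanish = begin
  Σᵥ f                    ≡⟨ +-identityʳ (Σᵥ f) ⟨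
  Σᵥ f + 0                ≡⟨ Σᵥ-update i vanish ⟩
  Σᵥ {n} (λ _ → 0) + f i  ≡⟨ cong (_+ f i) (Σᵥ-zero {n}) ⟩
  f i                     ∎
  where open ≡-Reasoning

Σᵥ-pos : ∀ {n} (f : Fin n → ℕ) → 0 < Σᵥ f → ∃ λ i → 0 < f i
Σᵥ-pos {n} f 0<Σf with any? (λ i → 0 <? f i)
... | yes found = found
... | no  none  = contradiction (subst (0 <_) (trans (Σᵥ-cong vanish) (Σᵥ-zero {n})) 0<Σf) n≮0
  where
  vanish : ∀ i → f i ≡ 0
  vanish i = n≤0⇒n≡0 (≮⇒≥ λ 0<fi → none (i , 0<fi))

Σᵥ-pos-avoiding : ∀ {n} (f : Fin n → ℕ) i → f i < Σᵥ f → ∃ λ j → j ≢ i × 0 < f j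
Σᵥ-pos-avoiding f i fi<Σf with any? (λ j → ¬? (j ≟ i) ×-dec 0 <? f j)
... | yes found = found
... | no  none  = contradiction fi<Σf (<-irrefl (sym (Σᵥ-single f i vanish)))
  where
  vanish : ∀ j → j ≢ i → f j ≡ 0
  vanish j j≢i = n≤0⇒n≡0 (≮⇒≥ λ 0<fj → none (j , j≢i , 0<fj))

infix 8 _≡ᵇ_

_≡ᵇ_ : ∀ {n} → Fin n → Fin n → Bool
i ≡ᵇ j = does (i ≟ j)

≡ᵇ-refl : ∀ {n} (i : Fin n) → (i ≡ᵇ i) ≡ true
≡ᵇ-refl i = dec-true (i ≟ i) refl

≢⇒≡ᵇ-false : ∀ {n} {i j : Fin n} → i ≢ j → (i ≡ᵇ j) ≡ false
≢⇒≡ᵇ-false {i = i} {j} = dec-false (i ≟ j)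

≡ᵇ-false⇒≢ : ∀ {n} {i j : Fin n} → (i ≡ᵇ j) ≡ false → i ≢ j
≡ᵇ-false⇒≢ {i = i} i≢ᵇi refl = contradiction (trans (sym (≡ᵇ-refl i)) i≢ᵇi) λ ()

≡ᵇ-true⇒≡ : ∀ {n} {i j : Fin n} → (i ≡ᵇ j) ≡ true → i ≡ j
≡ᵇ-true⇒≡ {i = i} {j} i≡ᵇj with i ≟ j
... | yes i≡j = i≡j

ind-pos : ∀ {b} → 0 < ind b → b ≡ true
ind-pos {true} _ = refl

ind≤1 : ∀ b → ind b ≤ 1
ind≤1 true  = ≤-refl
ind≤1 false = z≤n

ind-∨ : ∀ p q → ind (p ∨ q) ≤ ind p + ind q
ind-∨ true  q = s≤s z≤n
ind-∨ false q = ≤-refl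

ind-xor-triangle : ∀ x y z → ind (x xor z) ≤ ind (x xor y) + ind (y xor z)
ind-xor-triangle true  true  z     = m≤n+m _ 0
ind-xor-triangle true  false true  = z≤n
ind-xor-triangle true  false false = s≤s z≤n
ind-xor-triangle false true  true  = s≤s z≤n
ind-xor-triangle false true  false = z≤n
ind-xor-triangle false false z     = ≤-refl

Σᵥ-select : ∀ {n} (f : Fin n → ℕ) i → Σᵥ (λ j → ind (j ≡ᵇ i) * f j) ≡ f i
Σᵥ-select f i = begin
  Σᵥ (λ j → ind (j ≡ᵇ i) * f j)  ≡⟨ Σᵥ-single _ i (λ j → cong (λ b → ind b * f j) ∘ ≢⇒≡ᵇ-false) ⟩
  ind (i ≡ᵇ i) * f i             ≡⟨ cong (λ b → ind b * f i) (≡ᵇ-refl i) ⟩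
  1 * f i                        ≡⟨ *-identityˡ (f i) ⟩
  f i                            ∎
  where open ≡-Reasoning

Σᵥ-indicator : ∀ {n} (i : Fin n) → Σᵥ (λ j → ind (j ≡ᵇ i)) ≡ 1
Σᵥ-indicator i = trans (Σᵥ-cong λ j → sym (*-identityʳ (ind (j ≡ᵇ i)))) (Σᵥ-select (λ _ → 1) i)

Σᵥ-update₂ : ∀ {n} {f g : Fin n → ℕ} {u v} → u ≢ v → (∀ w → w ≢ u → w ≢ v → f w ≡ g w) →
             Σᵥ f + g u + g v ≡ Σᵥ g + f u + f v
Σᵥ-update₂ {n} {f} {g} {u} {v} u≢v agree = begin
  Σᵥ f + g u + g v  ≡⟨ cong (λ a → Σᵥ f + a + g v) h-u ⟨
  Σᵥ f + h u + g v  ≡⟨ cong (_+ g v) (Σᵥ-update u f≡h) ⟩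
  Σᵥ h + f u + g v  ≡⟨ xy∙z≈xz∙y (Σᵥ h) (f u) (g v) ⟩
  Σᵥ h + g v + f u  ≡⟨ cong (_+ f u) (Σᵥ-update v h≡g) ⟩
  Σᵥ g + h v + f u  ≡⟨ cong (λ a → Σᵥ g + a + f u) h-v ⟩
  Σᵥ g + f v + f u  ≡⟨ xy∙z≈xz∙y (Σᵥ g) (f v) (f u) ⟩
  Σᵥ g + f u + f v  ∎
  where
  open ≡-Reasoning
  h : Fin n → ℕ
  h w = if w ≡ᵇ u then g u else f w
  h-u : h u ≡ g u
  h-u rewrite ≡ᵇ-refl u = refl
  h-v : h v ≡ f v
  h-v rewrite ≢⇒≡ᵇ-false (u≢v ∘ sym) = refl
  f≡h : ∀ w → w ≢ u → f w ≡ h w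
  f≡h w w≢u rewrite ≢⇒≡ᵇ-false w≢u = refl
  h≡g : ∀ w → w ≢ v → h w ≡ g w
  h≡g w w≢v with w ≟ u
  ... | yes refl = refl
  ... | no w≢u   = agree w w≢u w≢v

does⇒ : ∀ {A : Set} (a? : Dec A) → does a? ≡ true → A
does⇒ (yes a) _ = a

count : ∀ {n} {P : Fin n → Set} → (∀ i → Dec (P i)) → ℕ
count P? = Σᵥ (λ i → ind (does (P? i)))

count-witness : ∀ {n} {P : Fin n → Set} (P? : ∀ i → Dec (P i)) → 0 < count P? → ∃ P
count-witness P? 0<count with Σᵥ-pos (λ i → ind (does (P? i))) 0<count
... | i , 0<ind = i , does⇒ (P? i) (ind-pos 0<ind)

count-witness-avoiding : ∀ {n} {P : Fin n → Set} (P? : ∀ i → Dec (P i)) i → 1 < count P? → ∃ λ j → j ≢ i × P j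
count-witness-avoiding P? i 1<count
  with Σᵥ-pos-avoiding (λ j → ind (does (P? j))) i (<-≤-trans (s≤s (ind≤1 (does (P? i)))) 1<count)
... | j , j≢i , 0<ind = j , j≢i , does⇒ (P? j) (ind-pos 0<ind)

witness⇒count-pos : ∀ {n} {P : Fin n → Set} (P? : ∀ i → Dec (P i)) {i} → P i → 0 < count P?
witness⇒count-pos P? {i} Pi = subst (λ b → ind b ≤ count P?) (dec-true (P? i) Pi) (Σᵥ-term (λ k → ind (does (P? k))) i)

count-mono : ∀ {n} {P : Fin n → Set} (P? : ∀ i → Dec (P i)) (q : Fin n → Bool) → (∀ {i} → P i → q i ≡ true) →
             count P? ≤ Σᵥ (ind ∘ q)
count-mono {P = P} P? q P⇒q = Σᵥ-mono λ i → bound (P? i)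
  where
  bound : ∀ {i} (P?ᵢ : Dec (P i)) → ind (does P?ᵢ) ≤ ind (q i)
  bound (yes Pi) = ≤-reflexive (cong ind (sym (P⇒q Pi)))
  bound (no _)   = z≤n

count-pair : ∀ {n} {P : Fin n → Set} (P? : ∀ i → Dec (P i)) {i j} → i ≢ j → P i → P j → 2 ≤ count P?
count-pair P? {i} {j} i≢j Pi Pj = subst₂ (λ a b → ind a + ind b ≤ count P?) (dec-true (P? i) Pi) (dec-true (P? j) Pj)
                                          (Σᵥ-pair (λ k → ind (does (P? k))) i≢j)

Σᵥ²-symmetric-even : ∀ {n} (a : Fin n → Fin n → ℕ) → (∀ i j → a i j ≡ a j i) → (∀ i → a i i ≡ 0) →
                     ∃ λ h → Σᵥ (λ i → Σᵥ (a i)) ≡ 2 * h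
Σᵥ²-symmetric-even {n} a symmetric diagonal = Σᵥ (λ i → Σᵥ (above i)) , (begin
  Σᵥ (λ i → Σᵥ (a i))
    ≡⟨ Σᵥ-cong (λ i → trans (Σᵥ-cong (split i)) (Σᵥ-distrib-+ (above i) (below i))) ⟩
  Σᵥ (λ i → Σᵥ (above i) + Σᵥ (below i))
    ≡⟨ Σᵥ-distrib-+ (λ i → Σᵥ (above i)) (λ i → Σᵥ (below i)) ⟩
  Σᵥ (λ i → Σᵥ (above i)) + Σᵥ (λ i → Σᵥ (below i))
    ≡⟨ cong (Σᵥ (λ i → Σᵥ (above i)) +_) (trans (Σᵥ-comm below) (Σᵥ-cong λ j → Σᵥ-cong λ i →
                                                   cong (ind (does (j Finₚ.<? i)) *_) (symmetric i j))) ⟩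
  Σᵥ (λ i → Σᵥ (above i)) + Σᵥ (λ i → Σᵥ (above i))
    ≡⟨ cong (Σᵥ (λ i → Σᵥ (above i)) +_) (+-identityʳ _) ⟨
  2 * Σᵥ (λ i → Σᵥ (above i)) ∎)
  where
  open ≡-Reasoning
  above below : Fin n → Fin n → ℕ
  above i j = ind (does (i Finₚ.<? j)) * a i j
  below i j = ind (does (j Finₚ.<? i)) * a i j
  split : ∀ i j → a i j ≡ above i j + below i j
  split i j with Finₚ.<-cmp i j
  ... | tri< i<j _ j≮i rewrite dec-true (i Finₚ.<? j) i<j | dec-false (j Finₚ.<? i) j≮i =
    sym (trans (+-identityʳ _) (+-identityʳ _))
  ... | tri≈ _ refl _ rewrite dec-false (i Finₚ.<? i) (Finₚ.<-irrefl refl) = diagonal i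
  ... | tri> i≮j _ j<i rewrite dec-false (i Finₚ.<? j) i≮j | dec-true (j Finₚ.<? i) j<i = sym (+-identityʳ _)

-- Degrees, edge toggles and vertex isolation

module _ {n : ℕ} where

  adj⇒≢ : ∀ (G : Graph n) {x y} → adj G x y ≡ true → x ≢ y
  adj⇒≢ G {x} x~y refl = contradiction (trans (sym x~y) (irrefl G x)) λ ()

  deg-cong : ∀ (G H : Graph n) {v} → (∀ w → adj G v w ≡ adj H v w) → deg G v ≡ deg H v
  deg-cong G H same = Σᵥ-cong (cong ind ∘ same)

  deg-isolated : ∀ (G : Graph n) {v} → (∀ w → adj G v w ≡ false) → deg G v ≡ 0
  deg-isolated G isolated = trans (Σᵥ-cong (cong ind ∘ isolated)) (Σᵥ-zero {n})

  deg-rowToggle : ∀ (G H : Graph n) {v o} → (∀ w → adj H v w ≡ adj G v w xor (w ≡ᵇ o)) →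
                deg H v + ind (adj G v o) ≡ deg G v + ind (not (adj G v o))
  deg-rowToggle G H {v} {o} row = begin
    deg H v + ind (adj G v o)  ≡⟨ Σᵥ-update o (λ w w≢o → cong ind (trans (row w) (off w≢o))) ⟩
    deg G v + ind (adj H v o)  ≡⟨ cong (λ b → deg G v + ind b) (trans (row o) (at-o)) ⟩
    deg G v + ind (not (adj G v o)) ∎
    where
    open ≡-Reasoning
    off : ∀ {w} → w ≢ o → adj G v w xor (w ≡ᵇ o) ≡ adj G v w
    off w≢o = trans (cong (adj G v _ xor_) (≢⇒≡ᵇ-false w≢o)) (xor-identityʳ _)
    at-o : adj G v o xor (o ≡ᵇ o) ≡ not (adj G v o)
    at-o = trans (cong (adj G v o xor_) (≡ᵇ-refl o)) (trans (xor-comm _ true) (true-xor _))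

  deg-addEdge : ∀ (G H : Graph n) {v o} → (∀ w → adj H v w ≡ adj G v w xor (w ≡ᵇ o)) →
                adj G v o ≡ false → deg H v ≡ suc (deg G v)
  deg-addEdge G H {v} {o} row v≁o = begin
    deg H v              ≡⟨ +-identityʳ (deg H v) ⟨
    deg H v + ind false  ≡⟨ subst (λ b → deg H v + ind b ≡ deg G v + ind (not b)) v≁o (deg-rowToggle G H row) ⟩
    deg G v + 1          ≡⟨ +-comm (deg G v) 1 ⟩
    suc (deg G v)        ∎
    where open ≡-Reasoning

  deg-removeEdge : ∀ (G H : Graph n) {v o} → (∀ w → adj H v w ≡ adj G v w xor (w ≡ᵇ o)) →
                   adj G v o ≡ true → suc (deg H v) ≡ deg G v
  deg-removeEdge G H {v} {o} row v~o = begin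
    suc (deg H v)       ≡⟨ +-comm 1 (deg H v) ⟩
    deg H v + ind true  ≡⟨ subst (λ b → deg H v + ind b ≡ deg G v + ind (not b)) v~o (deg-rowToggle G H row) ⟩
    deg G v + 0         ≡⟨ +-identityʳ (deg G v) ⟩
    deg G v             ∎
    where open ≡-Reasoning

  isPair : Fin n → Fin n → Fin n → Fin n → Bool
  isPair a b i j = (i ≡ᵇ a ∧ j ≡ᵇ b) ∨ (i ≡ᵇ b ∧ j ≡ᵇ a)

  isPair-sym : ∀ a b i j → isPair a b i j ≡ isPair a b j i
  isPair-sym a b i j =
    trans (∨-comm (i ≡ᵇ a ∧ j ≡ᵇ b) _) (cong₂ _∨_ (∧-comm (i ≡ᵇ b) _) (∧-comm (i ≡ᵇ a) _))

  isPair-irrefl : ∀ {a b} → a ≢ b → ∀ i → isPair a b i i ≡ false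
  isPair-irrefl {a} {b} a≢b i with i ≟ a | i ≟ b
  ... | yes refl | yes refl = contradiction refl a≢b
  ... | yes _    | no _     = refl
  ... | no _     | yes _    = refl
  ... | no _     | no _     = refl

  isPair-left : ∀ {a b} → a ≢ b → ∀ w → isPair a b a w ≡ w ≡ᵇ b
  isPair-left {a} a≢b w rewrite ≡ᵇ-refl a | ≢⇒≡ᵇ-false a≢b = ∨-identityʳ _

  isPair-right : ∀ {a b} → a ≢ b → ∀ w → isPair a b b w ≡ w ≡ᵇ a
  isPair-right {a} {b} a≢b w rewrite ≡ᵇ-refl b | ≢⇒≡ᵇ-false (a≢b ∘ sym) = refl

  isPair-other : ∀ {a b v} → v ≢ a → v ≢ b → ∀ w → isPair a b v w ≡ false
  isPair-other v≢a v≢b w rewrite ≢⇒≡ᵇ-false v≢a | ≢⇒≡ᵇ-false v≢b = refl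

  isPair-row-sum : ∀ {a b} → a ≢ b → ∀ i → Σᵥ (λ j → ind (isPair a b i j)) ≤ ind (i ≡ᵇ a) + ind (i ≡ᵇ b)
  isPair-row-sum {a} {b} a≢b i = by-cases (i ≟ a) (i ≟ b)
    where
    -- Matching on the decisions as arguments, not with `with`, leaves the i ≟ a inside isPair untouched.
    by-cases : Dec (i ≡ a) → Dec (i ≡ b) → Σᵥ (λ j → ind (isPair a b i j)) ≤ ind (i ≡ᵇ a) + ind (i ≡ᵇ b)
    by-cases (yes refl) _ = begin
      Σᵥ (λ j → ind (isPair a b a j))  ≡⟨ Σᵥ-cong (cong ind ∘ isPair-left a≢b) ⟩
      Σᵥ (λ j → ind (j ≡ᵇ b))          ≡⟨ trans (Σᵥ-indicator b) (cong ind (sym (≡ᵇ-refl a))) ⟩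
      ind (a ≡ᵇ a)                     ≤⟨ m≤m+n _ _ ⟩
      ind (a ≡ᵇ a) + ind (a ≡ᵇ b)      ∎
      where open ≤-Reasoning
    by-cases _ (yes refl) = begin
      Σᵥ (λ j → ind (isPair a b b j))  ≡⟨ Σᵥ-cong (cong ind ∘ isPair-right a≢b) ⟩
      Σᵥ (λ j → ind (j ≡ᵇ a))          ≡⟨ trans (Σᵥ-indicator a) (cong ind (sym (≡ᵇ-refl b))) ⟩
      ind (b ≡ᵇ b)                     ≤⟨ m≤n+m _ _ ⟩
      ind (b ≡ᵇ a) + ind (b ≡ᵇ b)      ∎
      where open ≤-Reasoning
    by-cases (no i≢a) (no i≢b) =
      ≤-trans (≤-reflexive (trans (Σᵥ-cong (cong ind ∘ isPair-other i≢a i≢b)) (Σᵥ-zero {n}))) z≤n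

  toggle : (G : Graph n) (a b : Fin n) → a ≢ b → Graph n
  toggle G a b a≢b = record
    { adj    = λ i j → adj G i j xor isPair a b i j
    ; sym    = λ i j → cong₂ _xor_ (Graph.sym G i j) (isPair-sym a b i j)
    ; irrefl = λ i → cong₂ _xor_ (irrefl G i) (isPair-irrefl a≢b i)
    }

  module _ (G : Graph n) {a b : Fin n} (a≢b : a ≢ b) where

    toggle-rowˡ : ∀ w → adj (toggle G a b a≢b) a w ≡ adj G a w xor w ≡ᵇ b
    toggle-rowˡ w = cong (adj G a w xor_) (isPair-left a≢b w)

    toggle-rowʳ : ∀ w → adj (toggle G a b a≢b) b w ≡ adj G b w xor w ≡ᵇ a
    toggle-rowʳ w = cong (adj G b w xor_) (isPair-right a≢b w)

    toggle-row-other : ∀ {v} → v ≢ a → v ≢ b → ∀ w → adj (toggle G a b a≢b) v w ≡ adj G v w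
    toggle-row-other v≢a v≢b w = trans (cong (adj G _ w xor_) (isPair-other v≢a v≢b w)) (xor-identityʳ _)

    deg-toggle-other : ∀ {v} → v ≢ a → v ≢ b → deg (toggle G a b a≢b) v ≡ deg G v
    deg-toggle-other v≢a v≢b = deg-cong (toggle G a b a≢b) G (toggle-row-other v≢a v≢b)

    deg-toggle-addˡ : adj G a b ≡ false → deg (toggle G a b a≢b) a ≡ suc (deg G a)
    deg-toggle-addˡ = deg-addEdge G (toggle G a b a≢b) toggle-rowˡ

    deg-toggle-addʳ : adj G a b ≡ false → deg (toggle G a b a≢b) b ≡ suc (deg G b)
    deg-toggle-addʳ a≁b = deg-addEdge G (toggle G a b a≢b) toggle-rowʳ (trans (Graph.sym G b a) a≁b)

    deg-toggle-removeˡ : adj G a b ≡ true → suc (deg (toggle G a b a≢b) a) ≡ deg G a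
    deg-toggle-removeˡ = deg-removeEdge G (toggle G a b a≢b) toggle-rowˡ

    deg-toggle-removeʳ : adj G a b ≡ true → suc (deg (toggle G a b a≢b) b) ≡ deg G b
    deg-toggle-removeʳ a~b = deg-removeEdge G (toggle G a b a≢b) toggle-rowʳ (trans (Graph.sym G b a) a~b)

  -- Counts ordered pairs: diffSum for the identity permutation, twice the number of edited edges.
  dist : Graph n → Graph n → ℕ
  dist G H = Σᵥ λ i → Σᵥ λ j → ind (adj G i j xor adj H i j)

  dist-self : ∀ G → dist G G ≡ 0
  dist-self G =
    trans (Σᵥ-cong λ i → trans (Σᵥ-cong λ j → cong ind (xor-same (adj G i j))) (Σᵥ-zero {n})) (Σᵥ-zero {n})

  dist-triangle : ∀ G H K → dist G K ≤ dist G H + dist H K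
  dist-triangle G H K = begin
    dist G K
      ≤⟨ Σᵥ-mono (λ i → Σᵥ-mono λ j → ind-xor-triangle (adj G i j) (adj H i j) (adj K i j)) ⟩
    Σᵥ (λ i → Σᵥ λ j → d G H i j + d H K i j)
      ≡⟨ Σᵥ-cong (λ i → Σᵥ-distrib-+ (d G H i) (d H K i)) ⟩
    Σᵥ (λ i → Σᵥ (d G H i) + Σᵥ (d H K i))
      ≡⟨ Σᵥ-distrib-+ (λ i → Σᵥ (d G H i)) (λ i → Σᵥ (d H K i)) ⟩
    dist G H + dist H K ∎
    where
    open ≤-Reasoning
    d : Graph n → Graph n → Fin n → Fin n → ℕ
    d X Y i j = ind (adj X i j xor adj Y i j)

  dist-toggle : ∀ G {a b} (a≢b : a ≢ b) → dist G (toggle G a b a≢b) ≤ 2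
  dist-toggle G {a} {b} a≢b = begin
    dist G (toggle G a b a≢b)
      ≡⟨ Σᵥ-cong (λ i → Σᵥ-cong λ j → cong ind (xor-cancelˡ (adj G i j) (isPair a b i j))) ⟩
    Σᵥ (λ i → Σᵥ λ j → ind (isPair a b i j))
      ≤⟨ Σᵥ-mono (isPair-row-sum a≢b) ⟩
    Σᵥ (λ i → ind (i ≡ᵇ a) + ind (i ≡ᵇ b))
      ≡⟨ Σᵥ-distrib-+ (λ i → ind (i ≡ᵇ a)) (λ i → ind (i ≡ᵇ b)) ⟩
    Σᵥ (λ i → ind (i ≡ᵇ a)) + Σᵥ (λ i → ind (i ≡ᵇ b))
      ≡⟨ cong₂ _+_ (Σᵥ-indicator a) (Σᵥ-indicator b) ⟩
    2 ∎
    where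
    open ≤-Reasoning
    xor-cancelˡ : ∀ x p → x xor (x xor p) ≡ p
    xor-cancelˡ x p = trans (sym (xor-assoc x x p)) (cong (_xor p) (xor-same x))

  isolate : Graph n → Fin n → Graph n
  isolate G u = record
    { adj    = λ i j → adj G i j ∧ not (i ≡ᵇ u) ∧ not (j ≡ᵇ u)
    ; sym    = λ i j → cong₂ _∧_ (Graph.sym G i j) (∧-comm (not (i ≡ᵇ u)) _)
    ; irrefl = λ i → cong (_∧ _) (irrefl G i)
    }

  isolate-isolated : ∀ G u w → adj (isolate G u) u w ≡ false
  isolate-isolated G u w rewrite ≡ᵇ-refl u = ∧-zeroʳ (adj G u w)

  deg-isolate : ∀ G {u v} → v ≢ u → deg (isolate G u) v + ind (adj G v u) ≡ deg G v
  deg-isolate G {u} {v} v≢u = begin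
    deg (isolate G u) v + ind (adj G v u)  ≡⟨ Σᵥ-update u (λ w w≢u → cong ind (kept w≢u)) ⟩
    deg G v + ind (adj (isolate G u) v u)  ≡⟨ cong (λ b → deg G v + ind b) cut ⟩
    deg G v + 0                            ≡⟨ +-identityʳ (deg G v) ⟩
    deg G v                                ∎
    where
    open ≡-Reasoning
    kept : ∀ {w} → w ≢ u → adj (isolate G u) v w ≡ adj G v w
    kept w≢u rewrite ≢⇒≡ᵇ-false v≢u | ≢⇒≡ᵇ-false w≢u = ∧-identityʳ _
    cut : adj (isolate G u) v u ≡ false
    cut rewrite ≢⇒≡ᵇ-false v≢u | ≡ᵇ-refl u = ∧-zeroʳ _

  dist-isolate : ∀ G u → dist G (isolate G u) ≤ 2 * deg G u
  dist-isolate G u = begin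
    dist G (isolate G u)
      ≤⟨ Σᵥ-mono (λ i → Σᵥ-mono λ j → cut-bound (adj G i j) (i ≡ᵇ u) (j ≡ᵇ u)) ⟩
    Σᵥ (λ i → Σᵥ λ j → ind (i ≡ᵇ u) * A i j + ind (j ≡ᵇ u) * A i j)
      ≡⟨ Σᵥ-cong (λ i → Σᵥ-distrib-+ (λ j → ind (i ≡ᵇ u) * A i j) (λ j → ind (j ≡ᵇ u) * A i j)) ⟩
    Σᵥ (λ i → Σᵥ (λ j → ind (i ≡ᵇ u) * A i j) + Σᵥ (λ j → ind (j ≡ᵇ u) * A i j))
      ≡⟨ Σᵥ-cong (λ i → cong₂ _+_ (sym (*-distribˡ-Σᵥ (ind (i ≡ᵇ u)) (A i))) (Σᵥ-select (A i) u)) ⟩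
    Σᵥ (λ i → ind (i ≡ᵇ u) * deg G i + A i u)
      ≡⟨ Σᵥ-distrib-+ (λ i → ind (i ≡ᵇ u) * deg G i) (λ i → A i u) ⟩
    Σᵥ (λ i → ind (i ≡ᵇ u) * deg G i) + Σᵥ (λ i → A i u)
      ≡⟨ cong₂ _+_ (Σᵥ-select (deg G) u) (Σᵥ-cong λ i → cong ind (Graph.sym G i u)) ⟩
    deg G u + deg G u
      ≡⟨ cong (deg G u +_) (+-identityʳ (deg G u)) ⟨
    2 * deg G u ∎
    where
    open ≤-Reasoning
    A : Fin n → Fin n → ℕ
    A i j = ind (adj G i j)
    cut-bound : ∀ x p q → ind (x xor (x ∧ not p ∧ not q)) ≤ ind p * ind x + ind q * ind x
    cut-bound true  true  q     = s≤s z≤n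
    cut-bound true  false true  = s≤s z≤n
    cut-bound true  false false = z≤n
    cut-bound false p     q     = z≤n

  degreeSum-even : ∀ (G : Graph n) → ∃ λ h → Σᵥ (deg G) ≡ 2 * h
  degreeSum-even G =
    Σᵥ²-symmetric-even (λ i j → ind (adj G i j)) (λ i j → cong ind (Graph.sym G i j)) (cong ind ∘ irrefl G)

  regular-or-isolated⇒componentwiseRegular : ∀ (G : Graph n) Δ →
    (∀ v → deg G v ≡ Δ ⊎ (∀ w → adj G v w ≡ false)) → ComponentwiseRegular G
  regular-or-isolated⇒componentwiseRegular G Δ regular-or-isolated = regular
    where
    nonisolated : ∀ {v w} → adj G v w ≡ true → deg G v ≡ Δ
    nonisolated {v} {w} v~w with regular-or-isolated v
    ... | inj₁ deg≡Δ   = deg≡Δ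
    ... | inj₂ isolated = contradiction (trans (sym v~w) (isolated w)) λ ()
    endpoint : ∀ {u v} → Reach G u v → u ≡ v ⊎ deg G v ≡ Δ
    endpoint here = inj₁ refl
    endpoint (step {u} {w} u~w w⇝v) with endpoint w⇝v
    ... | inj₁ refl = inj₂ (nonisolated (trans (Graph.sym G w u) u~w))
    ... | inj₂ deg≡Δ = inj₂ deg≡Δ
    regular : ComponentwiseRegular G
    regular u v here = refl
    regular u v (step u~w w⇝v) with endpoint (step u~w w⇝v)
    ... | inj₁ refl  = refl
    ... | inj₂ deg≡Δ = trans (nonisolated u~w) (sym deg≡Δ)

  closedNbhd : Graph n → Fin n → Fin n → Bool
  closedNbhd G u x = adj G u x ∨ x ≡ᵇ u

  closedNbhd-size : ∀ G u → Σᵥ (ind ∘ closedNbhd G u) ≤ suc (deg G u)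
  closedNbhd-size G u = begin
    Σᵥ (ind ∘ closedNbhd G u)                    ≤⟨ Σᵥ-mono (λ x → ind-∨ (adj G u x) (x ≡ᵇ u)) ⟩
    Σᵥ (λ x → ind (adj G u x) + ind (x ≡ᵇ u))    ≡⟨ Σᵥ-distrib-+ (ind ∘ adj G u) (λ x → ind (x ≡ᵇ u)) ⟩
    deg G u + Σᵥ (λ x → ind (x ≡ᵇ u))            ≡⟨ cong (deg G u +_) (Σᵥ-indicator u) ⟩
    deg G u + 1                                  ≡⟨ +-comm (deg G u) 1 ⟩
    suc (deg G u)                                ∎
    where open ≤-Reasoning

  closedNbhd-degreeSum : ∀ G u {D} → (∀ x → deg G x ≤ D) →
                         Σᵥ (λ x → ind (closedNbhd G u x) * deg G x) ≤ suc (deg G u) * D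
  closedNbhd-degreeSum G u {D} deg≤D = begin
    Σᵥ (λ x → ind (closedNbhd G u x) * deg G x)  ≤⟨ Σᵥ-mono (λ x → *-monoʳ-≤ (ind (closedNbhd G u x)) (deg≤D x)) ⟩
    Σᵥ (λ x → ind (closedNbhd G u x) * D)        ≡⟨ Σᵥ-cong (λ x → *-comm (ind (closedNbhd G u x)) D) ⟩
    Σᵥ (λ x → D * ind (closedNbhd G u x))        ≡⟨ *-distribˡ-Σᵥ D (ind ∘ closedNbhd G u) ⟨
    D * Σᵥ (ind ∘ closedNbhd G u)                ≤⟨ *-monoʳ-≤ D (closedNbhd-size G u) ⟩
    D * suc (deg G u)                            ≡⟨ *-comm D (suc (deg G u)) ⟩
    suc (deg G u) * D                            ∎
    where open ≤-Reasoning

  isFarEdge : Graph n → Fin n → Fin n → Fin n → Fin n → Bool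
  isFarEdge G u v x y = adj G x y ∧ not (closedNbhd G u x) ∧ not (closedNbhd G v y)

  degreeSum-≤-farEdges : ∀ (G : Graph n) u v →
    Σᵥ (deg G) ≤ Σᵥ (λ x → Σᵥ (ind ∘ isFarEdge G u v x))
                 + Σᵥ (λ x → ind (closedNbhd G u x) * deg G x)
                 + Σᵥ (λ y → ind (closedNbhd G v y) * deg G y)
  degreeSum-≤-farEdges G u v = begin
    Σᵥ (deg G)
      ≤⟨ Σᵥ-mono (λ x → Σᵥ-mono λ y → edge-split (adj G x y) (closedNbhd G u x) (closedNbhd G v y)) ⟩
    Σᵥ (λ x → Σᵥ λ y → F x y + P x * A x y + Q y * A x y)
      ≡⟨ Σᵥ-cong (λ x → trans (Σᵥ-distrib-+ (λ y → F x y + P x * A x y) (λ y → Q y * A x y))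
                              (cong (_+ Σᵥ (λ y → Q y * A x y)) (Σᵥ-distrib-+ (F x) (λ y → P x * A x y)))) ⟩
    Σᵥ (λ x → Σᵥ (F x) + Σᵥ (λ y → P x * A x y) + Σᵥ (λ y → Q y * A x y))
      ≡⟨ trans (Σᵥ-distrib-+ (λ x → Σᵥ (F x) + Σᵥ (λ y → P x * A x y)) (λ x → Σᵥ (λ y → Q y * A x y)))
               (cong (_+ Σᵥ (λ x → Σᵥ (λ y → Q y * A x y)))
                     (Σᵥ-distrib-+ (λ x → Σᵥ (F x)) (λ x → Σᵥ (λ y → P x * A x y)))) ⟩
    Σᵥ (λ x → Σᵥ (F x)) + Σᵥ (λ x → Σᵥ (λ y → P x * A x y)) + Σᵥ (λ x → Σᵥ (λ y → Q y * A x y))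
      ≡⟨ cong₂ (λ s t → Σᵥ (λ x → Σᵥ (F x)) + s + t)
               (Σᵥ-cong λ x → sym (*-distribˡ-Σᵥ (P x) (A x)))
               (trans (Σᵥ-comm (λ x y → Q y * A x y)) (Σᵥ-cong λ y → sym (*-distribˡ-Σᵥ (Q y) (λ x → A x y)))) ⟩
    Σᵥ (λ x → Σᵥ (F x)) + Σᵥ (λ x → P x * deg G x) + Σᵥ (λ y → Q y * Σᵥ (λ x → A x y))
      ≡⟨ cong (Σᵥ (λ x → Σᵥ (F x)) + Σᵥ (λ x → P x * deg G x) +_)
              (Σᵥ-cong λ y → cong (Q y *_) (Σᵥ-cong λ x → cong ind (Graph.sym G x y))) ⟩
    Σᵥ (λ x → Σᵥ (F x)) + Σᵥ (λ x → P x * deg G x) + Σᵥ (λ y → Q y * deg G y) ∎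
    where
    open ≤-Reasoning
    A F : Fin n → Fin n → ℕ
    A x y = ind (adj G x y)
    F x y = ind (isFarEdge G u v x y)
    P Q : Fin n → ℕ
    P x = ind (closedNbhd G u x)
    Q y = ind (closedNbhd G v y)
    edge-split : ∀ a p q → ind a ≤ ind (a ∧ not p ∧ not q) + ind p * ind a + ind q * ind a
    edge-split false p     q     = z≤n
    edge-split true  true  q     = s≤s z≤n
    edge-split true  false true  = s≤s z≤n
    edge-split true  false false = s≤s z≤n

  record FarEdge (G : Graph n) (u v : Fin n) : Set where
    field
      x y : Fin n
      x~y : adj G x y ≡ true
      u≁x : adj G u x ≡ false
      x≢u : x ≢ u
      v≁y : adj G v y ≡ false
      y≢v : y ≢ v

  isFarEdge⇒FarEdge : ∀ G {u v x y} → isFarEdge G u v x y ≡ true → FarEdge G u v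
  isFarEdge⇒FarEdge G {u} {v} {x} {y} far = record
    { x = x ; y = y
    ; x~y = ∧-conicalˡ (adj G x y) _ far
    ; u≁x = ∨-conicalˡ _ _ x∉N[u]
    ; x≢u = ≡ᵇ-false⇒≢ (∨-conicalʳ _ _ x∉N[u])
    ; v≁y = ∨-conicalˡ _ _ y∉N[v]
    ; y≢v = ≡ᵇ-false⇒≢ (∨-conicalʳ _ _ y∉N[v])
    }
    where
    outside : not (closedNbhd G u x) ∧ not (closedNbhd G v y) ≡ true
    outside = ∧-conicalʳ (adj G x y) _ far
    x∉N[u] : closedNbhd G u x ≡ false
    x∉N[u] = not-injective (∧-conicalˡ _ _ outside)
    y∉N[v] : closedNbhd G v y ≡ false
    y∉N[v] = not-injective (∧-conicalʳ _ _ outside)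

  record RaisesPair (G H : Graph n) (u v : Fin n) : Set where
    field
      raiseˡ        : deg H u ≡ suc (deg G u)
      raiseʳ        : deg H v ≡ suc (deg G v)
      keep          : ∀ {w} → w ≢ u → w ≢ v → deg H w ≡ deg G w
      keep-isolated : ∀ {w} → w ≢ u → w ≢ v → (∀ z → adj G w z ≡ false) → ∀ z → adj H w z ≡ false

  toggle-raisesPair : ∀ G {u v} (u≢v : u ≢ v) → adj G u v ≡ false → RaisesPair G (toggle G u v u≢v) u v
  toggle-raisesPair G u≢v u≁v = record
    { raiseˡ        = deg-toggle-addˡ G u≢v u≁v
    ; raiseʳ        = deg-toggle-addʳ G u≢v u≁v
    ; keep          = deg-toggle-other G u≢v
    ; keep-isolated = λ w≢u w≢v isolated z → trans (toggle-row-other G u≢v w≢u w≢v z) (isolated z)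
    }

  module _ {G : Graph n} {u v : Fin n} (far : FarEdge G u v) where
    open FarEdge far

    private
      x≢y : x ≢ y
      x≢y = adj⇒≢ G x~y
      u≢x : u ≢ x
      u≢x = x≢u ∘ sym
      v≢y : v ≢ y
      v≢y = y≢v ∘ sym
      G₁ G₂ : Graph n
      G₁ = toggle G x y x≢y
      G₂ = toggle G₁ u x u≢x

    rewire : Graph n
    rewire = toggle G₂ v y v≢y

    dist-rewire : dist G rewire ≤ 6
    dist-rewire = begin
      dist G rewire                              ≤⟨ dist-triangle G G₁ rewire ⟩
      dist G G₁ + dist G₁ rewire                 ≤⟨ +-monoʳ-≤ (dist G G₁) (dist-triangle G₁ G₂ rewire) ⟩
      dist G G₁ + (dist G₁ G₂ + dist G₂ rewire)
        ≤⟨ +-mono-≤ (dist-toggle G x≢y) (+-mono-≤ (dist-toggle G₁ u≢x) (dist-toggle G₂ v≢y)) ⟩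
      6                                          ∎
      where open ≤-Reasoning

    rewire-row-other : ∀ {w} → w ≢ u → w ≢ v → w ≢ x → w ≢ y → ∀ z → adj rewire w z ≡ adj G w z
    rewire-row-other w≢u w≢v w≢x w≢y z =
      trans (toggle-row-other G₂ v≢y w≢v w≢y z)
            (trans (toggle-row-other G₁ u≢x w≢u w≢x z) (toggle-row-other G x≢y w≢x w≢y z))

    rewire-raisesPair : u ≢ v → adj G u v ≡ true → RaisesPair G rewire u v
    rewire-raisesPair u≢v u~v = record
      { raiseˡ        = trans (deg-toggle-other G₂ v≢y u≢v u≢y)
                              (trans (deg-toggle-addˡ G₁ u≢x u≁₁x) (cong suc (deg-toggle-other G x≢y u≢x u≢y)))
      ; raiseʳ        = trans (deg-toggle-addˡ G₂ v≢y v≁₂y)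
                              (cong suc (trans (deg-toggle-other G₁ u≢x (u≢v ∘ sym) v≢x)
                                               (deg-toggle-other G x≢y v≢x v≢y)))
      ; keep          = keep
      ; keep-isolated = λ w≢u w≢v isolated z →
          trans (rewire-row-other w≢u w≢v (has-edge isolated x~y) (has-edge isolated (trans (Graph.sym G y x) x~y)) z)
                (isolated z)
      }
      where
      u≢y : u ≢ y
      u≢y refl = contradiction (trans (sym u~v) (trans (Graph.sym G u v) v≁y)) λ ()
      v≢x : v ≢ x
      v≢x refl = contradiction (trans (sym u~v) u≁x) λ ()
      u≁₁x : adj G₁ u x ≡ false
      u≁₁x = trans (toggle-row-other G x≢y u≢x u≢y x) u≁x
      v≁₂y : adj G₂ v y ≡ false
      v≁₂y = trans (toggle-row-other G₁ u≢x (u≢v ∘ sym) v≢x y) (trans (toggle-row-other G x≢y v≢x v≢y y) v≁y)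
      has-edge : ∀ {w a b} → (∀ z → adj G w z ≡ false) → adj G a b ≡ true → w ≢ a
      has-edge {b = b} isolated a~b refl = contradiction (trans (sym a~b) (isolated b)) λ ()
      keep : ∀ {w} → w ≢ u → w ≢ v → deg rewire w ≡ deg G w
      keep {w} w≢u w≢v = by-cases (w ≟ x) (w ≟ y)
        where
        by-cases : Dec (w ≡ x) → Dec (w ≡ y) → deg rewire w ≡ deg G w
        by-cases (yes refl) _ = trans (deg-toggle-other G₂ v≢y (v≢x ∘ sym) x≢y)
                                      (trans (deg-toggle-addʳ G₁ u≢x u≁₁x) (deg-toggle-removeˡ G x≢y x~y))
        by-cases _ (yes refl) = trans (deg-toggle-addʳ G₂ v≢y v≁₂y)
                                      (trans (cong suc (deg-toggle-other G₁ u≢x (u≢y ∘ sym) (x≢y ∘ sym)))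
                                             (deg-toggle-removeʳ G x≢y x~y))
        by-cases (no w≢x) (no w≢y) = deg-cong rewire G (rewire-row-other w≢u w≢v w≢x w≢y)

-- Repairing deficient vertices in pairs

-- Frozen vertices are kept isolated and never count as deficient; in the odd
-- case the vertex that has been isolated is frozen.  The bound on n is only
-- needed once some vertex is deficient, which forces Δ ≥ 1.
module Repair {n : ℕ} (Δ : ℕ) (frozen : Fin n → Bool)
              (room : 1 ≤ Δ → 2 * Δ + 3 ≤ n) (few-frozen : Σᵥ (ind ∘ frozen) ≤ 1) where
  Deficient : Graph n → Fin n → Set
  Deficient G v = frozen v ≡ false × suc (deg G v) ≡ Δ

  deficient? : ∀ G v → Dec (Deficient G v)
  deficient? G v = frozen v Bool.≟ false ×-dec suc (deg G v) ℕ.≟ Δ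

  defect : Graph n → ℕ
  defect G = count (deficient? G)

  record Admissible (G : Graph n) : Set where
    field
      frozen-isolated : ∀ {v} → frozen v ≡ true → ∀ w → adj G v w ≡ false
      near-regular    : ∀ {v} → frozen v ≡ false → deg G v ≡ Δ ⊎ suc (deg G v) ≡ Δ
  open Admissible

  deg≤Δ : ∀ {G} → Admissible G → ∀ v → deg G v ≤ Δ
  deg≤Δ {G} adm v with frozen v in frozen-v
  ... | true  = ≤-trans (≤-reflexive (deg-isolated G (frozen-isolated adm frozen-v))) z≤n
  ... | false with near-regular adm frozen-v
  ...   | inj₁ deg≡Δ  = ≤-reflexive deg≡Δ
  ...   | inj₂ suc≡Δ  = ≤-trans (n≤1+n _) (≤-reflexive suc≡Δ)

  degreeSum-defect : ∀ {G} → Admissible G → Σᵥ (deg G) + defect G + Δ * Σᵥ (ind ∘ frozen) ≡ n * Δ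
  degreeSum-defect {G} adm = begin
    Σᵥ (deg G) + defect G + Δ * Σᵥ (ind ∘ frozen)
      ≡⟨ cong₂ _+_ (sym (Σᵥ-distrib-+ (deg G) (λ v → ind (does (deficient? G v)))))
                   (*-distribˡ-Σᵥ Δ (ind ∘ frozen)) ⟩
    Σᵥ (λ v → deg G v + ind (does (deficient? G v))) + Σᵥ (λ v → Δ * ind (frozen v))
      ≡⟨ sym (Σᵥ-distrib-+ (λ v → deg G v + ind (does (deficient? G v))) (λ v → Δ * ind (frozen v))) ⟩
    Σᵥ (λ v → deg G v + ind (does (deficient? G v)) + Δ * ind (frozen v))
      ≡⟨ Σᵥ-cong vertex-share ⟩
    Σᵥ {n} (λ _ → Δ)
      ≡⟨ Σᵥ-const {n} Δ ⟩
    n * Δ ∎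
    where
    open ≡-Reasoning
    vertex-share : ∀ v → deg G v + ind (does (deficient? G v)) + Δ * ind (frozen v) ≡ Δ
    vertex-share v with frozen v in frozen-v
    ... | true rewrite deg-isolated G (frozen-isolated adm frozen-v) = *-identityʳ Δ
    ... | false with near-regular adm frozen-v
    ...   | inj₁ deg≡Δ
      rewrite dec-false (suc (deg G v) ℕ.≟ Δ) (λ suc≡Δ → 1+n≢n (trans suc≡Δ (sym deg≡Δ))) | *-zeroʳ Δ =
      trans (+-identityʳ _) (trans (+-identityʳ _) deg≡Δ)
    ...   | inj₂ suc≡Δ rewrite dec-true (suc (deg G v) ℕ.≟ Δ) suc≡Δ | *-zeroʳ Δ =
      trans (+-identityʳ _) (trans (+-comm (deg G v) 1) suc≡Δ)

  raisesPair-admissible : ∀ {G H u v} → Admissible G → Deficient G u → Deficient G v → u ≢ v → RaisesPair G H u v →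
                          Admissible H × defect G ≡ 2 + defect H
  raisesPair-admissible {G} {H} {u} {v} adm (frozen-u , suc≡Δᵤ) (frozen-v , suc≡Δᵥ) u≢v raises =
    record { frozen-isolated = isolated ; near-regular = near } , defect-drop
    where
    open RaisesPair raises
    thawed : ∀ {w} → frozen w ≡ true → frozen w ≡ false → ⊥
    thawed f t = contradiction (trans (sym f) t) λ ()
    isolated : ∀ {w} → frozen w ≡ true → ∀ z → adj H w z ≡ false
    isolated frozen-w = keep-isolated (λ { refl → thawed frozen-w frozen-u }) (λ { refl → thawed frozen-w frozen-v })
                                      (frozen-isolated adm frozen-w)
    near : ∀ {w} → frozen w ≡ false → deg H w ≡ Δ ⊎ suc (deg H w) ≡ Δ
    near {w} frozen-w with w ≟ u | w ≟ v
    ... | yes refl | _        = inj₁ (trans raiseˡ suc≡Δᵤ)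
    ... | no _     | yes refl = inj₁ (trans raiseʳ suc≡Δᵥ)
    ... | no w≢u   | no w≢v   rewrite keep w≢u w≢v = near-regular adm frozen-w
    full : ∀ {w} → deg H w ≡ Δ → does (deficient? H w) ≡ false
    full deg≡Δ = dec-false (deficient? H _) λ (_ , suc≡Δ) → 1+n≢n (trans suc≡Δ (sym deg≡Δ))
    defect-drop : defect G ≡ 2 + defect H
    defect-drop = begin
      defect G
        ≡⟨ trans (+-identityʳ _) (+-identityʳ _) ⟨
      defect G + 0 + 0
        ≡⟨ cong₂ (λ a b → defect G + ind a + ind b) (full (trans raiseˡ suc≡Δᵤ)) (full (trans raiseʳ suc≡Δᵥ)) ⟨
      defect G + ind (does (deficient? H u)) + ind (does (deficient? H v))
        ≡⟨ Σᵥ-update₂ u≢v (λ w w≢u w≢v → cong (λ d → ind (does (frozen w Bool.≟ false ×-dec suc d ℕ.≟ Δ)))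
                                                (sym (keep w≢u w≢v))) ⟩
      defect H + ind (does (deficient? G u)) + ind (does (deficient? G v))
        ≡⟨ cong₂ (λ a b → defect H + ind a + ind b) (dec-true (deficient? G u) (frozen-u , suc≡Δᵤ))
                                                     (dec-true (deficient? G v) (frozen-v , suc≡Δᵥ)) ⟩
      defect H + 1 + 1
        ≡⟨ trans (+-comm (defect H + 1) 1) (cong suc (+-comm (defect H) 1)) ⟩
      2 + defect H ∎
      where open ≡-Reasoning

  defect≤Δ : ∀ {G u} → Deficient G u → (∀ {v} → Deficient G v → v ≢ u → adj G u v ≡ true) → defect G ≤ Δ
  defect≤Δ {G} {u} (_ , suc≡Δ) neighbours = begin
    defect G                   ≤⟨ count-mono (deficient? G) (closedNbhd G u) inside ⟩
    Σᵥ (ind ∘ closedNbhd G u)  ≤⟨ closedNbhd-size G u ⟩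
    suc (deg G u)              ≡⟨ suc≡Δ ⟩
    Δ                          ∎
    where
    open ≤-Reasoning
    inside : ∀ {v} → Deficient G v → closedNbhd G u v ≡ true
    inside {v} v-def with v ≟ u
    ... | yes refl = ∨-zeroʳ (adj G v v)
    ... | no v≢u rewrite neighbours v-def v≢u = refl

  -- Σ deg = nΔ − defect − Δ·#frozen ≥ nΔ − 2Δ, while the pairs xy with x ∈ N[u] or y ∈ N[v]
  -- contribute at most 2Δ² to Σ deg; n ≥ 2Δ + 3 leaves room for a far edge.
  farEdges-positive : ∀ {G u v} → Admissible G → Deficient G u → Deficient G v → defect G ≤ Δ →
                      0 < Σᵥ (λ x → Σᵥ (ind ∘ isFarEdge G u v x))
  farEdges-positive {G} {u} {v} adm (_ , suc≡Δᵤ) (_ , suc≡Δᵥ) defect≤Δ =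
    ≤-trans 1≤Δ (+-cancelˡ-≤ (Δ * Δ + Δ * Δ + Δ + Δ) Δ S counting)
    where
    S : ℕ
    S = Σᵥ (λ x → Σᵥ (ind ∘ isFarEdge G u v x))
    1≤Δ : 1 ≤ Δ
    1≤Δ = subst (1 ≤_) suc≡Δᵤ (s≤s z≤n)
    counting : Δ * Δ + Δ * Δ + Δ + Δ + Δ ≤ Δ * Δ + Δ * Δ + Δ + Δ + S
    counting = begin
      Δ * Δ + Δ * Δ + Δ + Δ + Δ
        ≡⟨ regroup Δ ⟩
      (2 * Δ + 3) * Δ
        ≤⟨ *-monoˡ-≤ Δ (room 1≤Δ) ⟩
      n * Δ
        ≡⟨ degreeSum-defect adm ⟨
      Σᵥ (deg G) + defect G + Δ * Σᵥ (ind ∘ frozen)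
        ≤⟨ +-mono-≤ (+-monoʳ-≤ (Σᵥ (deg G)) defect≤Δ) (*-monoʳ-≤ Δ few-frozen) ⟩
      Σᵥ (deg G) + Δ + Δ * 1
        ≤⟨ +-monoˡ-≤ (Δ * 1) (+-monoˡ-≤ Δ (degreeSum-≤-farEdges G u v)) ⟩
      S + Σᵥ (λ x → ind (closedNbhd G u x) * deg G x) + Σᵥ (λ y → ind (closedNbhd G v y) * deg G y) + Δ + Δ * 1
        ≤⟨ +-monoˡ-≤ (Δ * 1) (+-monoˡ-≤ Δ (+-mono-≤ (+-monoʳ-≤ S (closedNbhd-degreeSum G u (deg≤Δ adm)))
                                                      (closedNbhd-degreeSum G v (deg≤Δ adm)))) ⟩
      S + suc (deg G u) * Δ + suc (deg G v) * Δ + Δ + Δ * 1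
        ≡⟨ cong₂ (λ a b → S + a * Δ + b * Δ + Δ + Δ * 1) suc≡Δᵤ suc≡Δᵥ ⟩
      S + Δ * Δ + Δ * Δ + Δ + Δ * 1
        ≡⟨ regroup′ S Δ ⟩
      Δ * Δ + Δ * Δ + Δ + Δ + S ∎
      where
      open ≤-Reasoning
      regroup : ∀ d → d * d + d * d + d + d + d ≡ (2 * d + 3) * d
      regroup = solve-∀
      regroup′ : ∀ s d → s + d * d + d * d + d + d * 1 ≡ d * d + d * d + d + d + s
      regroup′ = solve-∀

  farEdge-exists : ∀ {G u v} → Admissible G → Deficient G u → Deficient G v → defect G ≤ Δ → FarEdge G u v
  farEdge-exists {G} {u} {v} adm u-def v-def defect≤Δ
    with Σᵥ-pos (λ x → Σᵥ (ind ∘ isFarEdge G u v x)) (farEdges-positive adm u-def v-def defect≤Δ)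
  ... | x , 0<row with Σᵥ-pos (ind ∘ isFarEdge G u v x) 0<row
  ...   | y , 0<ind = isFarEdge⇒FarEdge G (ind-pos 0<ind)

  -- One edit per repaired pair, plus two more per pair once at most Δ vertices are deficient.
  edits : ℕ → ℕ
  edits m = m + m ⊓ Δ

  edits-join : ∀ m → 1 + edits m ≤ edits (2 + m)
  edits-join m = +-mono-≤ (n≤1+n (suc m)) (⊓-monoˡ-≤ Δ (m≤n+m m 2))

  edits-rewire : ∀ m → 2 + m ≤ Δ → 3 + edits m ≤ edits (2 + m)
  edits-rewire m 2+m≤Δ = begin
    3 + m + m ⊓ Δ        ≤⟨ +-monoʳ-≤ (3 + m) (m⊓n≤m m Δ) ⟩
    3 + m + m            ≤⟨ n≤1+n _ ⟩
    4 + m + m            ≡⟨ regroup m ⟩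
    (2 + m) + (2 + m)    ≡⟨ cong ((2 + m) +_) (m≤n⇒m⊓n≡m 2+m≤Δ) ⟨
    edits (2 + m)        ∎
    where
    open ≤-Reasoning
    regroup : ∀ m → 4 + m + m ≡ (2 + m) + (2 + m)
    regroup = solve-∀

  edits≤ : ∀ m → edits m ≤ m + Δ
  edits≤ m = +-monoʳ-≤ m (m⊓n≤n m Δ)

  RepairStep : Graph n → ℕ → Set
  RepairStep G m = Σ (Graph n) λ H → Admissible H × defect H ≡ m × dist G H + 2 * edits m ≤ 2 * edits (2 + m)

  raisesPair-step : ∀ {G H u v m} → Admissible G → defect G ≡ 2 + m → Deficient G u → Deficient G v → u ≢ v →
                    RaisesPair G H u v → ∀ e → dist G H ≤ 2 * e → e + edits m ≤ edits (2 + m) → RepairStep G m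
  raisesPair-step {G} {H} {m = m} adm defect≡ u-def v-def u≢v raises e dist≤ e+edits≤
    with raisesPair-admissible adm u-def v-def u≢v raises
  ... | admissible , defect-drop = H , admissible , suc-injective (suc-injective (trans (sym defect-drop) defect≡)) , cost
    where
    cost : dist G H + 2 * edits m ≤ 2 * edits (2 + m)
    cost = begin
      dist G H + 2 * edits m  ≤⟨ +-monoˡ-≤ (2 * edits m) dist≤ ⟩
      2 * e + 2 * edits m     ≡⟨ *-distribˡ-+ 2 e (edits m) ⟨
      2 * (e + edits m)       ≤⟨ *-monoʳ-≤ 2 e+edits≤ ⟩
      2 * edits (2 + m)       ∎
      where open ≤-Reasoning

  repairStep : ∀ {G m} → Admissible G → defect G ≡ 2 + m → RepairStep G m
  repairStep {G} {m} adm defect≡ with count-witness (deficient? G) (subst (0 <_) (sym defect≡) (s≤s z≤n))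
  ... | u , u-def with any? (λ v → deficient? G v ×-dec ¬? (v ≟ u) ×-dec adj G u v Bool.≟ false)
  ...   | yes (v , v-def , v≢u , u≁v) =
    raisesPair-step adm defect≡ u-def v-def (v≢u ∘ sym) (toggle-raisesPair G (v≢u ∘ sym) u≁v)
                    1 (dist-toggle G (v≢u ∘ sym)) (edits-join m)
  ...   | no no-gap with count-witness-avoiding (deficient? G) u (subst (1 <_) (sym defect≡) (s≤s (s≤s z≤n)))
  ...     | v , v≢u , v-def =
    raisesPair-step adm defect≡ u-def v-def (v≢u ∘ sym) (rewire-raisesPair far (v≢u ∘ sym) (neighbours v-def v≢u))
                    3 (dist-rewire far) (edits-rewire m (subst (_≤ Δ) defect≡ small))
    where
    neighbours : ∀ {w} → Deficient G w → w ≢ u → adj G u w ≡ true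
    neighbours {w} w-def w≢u with adj G u w in u~w
    ... | true  = refl
    ... | false = contradiction (w , w-def , w≢u , u~w) no-gap
    small : defect G ≤ Δ
    small = defect≤Δ {G} {u} u-def neighbours
    far : FarEdge G u v
    far = farEdge-exists adm u-def v-def small

  repair : ∀ m {G} → Admissible G → defect G ≡ m →
           Σ (Graph n) λ H → Admissible H × (defect H ≡ 0 ⊎ defect H ≡ 1) × dist G H ≤ 2 * edits m
  repair 0             {G} adm defect≡ = G , adm , inj₁ defect≡ , ≤-reflexive (dist-self G)
  repair 1             {G} adm defect≡ = G , adm , inj₂ defect≡ , ≤-trans (≤-reflexive (dist-self G)) z≤n
  repair (suc (suc m)) {G} adm defect≡ with repairStep adm defect≡
  ... | H , admH , defectH , cost with repair m admH defectH
  ...   | K , admK , defectK , cost′ =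
    K , admK , defectK , ≤-trans (dist-triangle G H K) (≤-trans (+-monoʳ-≤ (dist G H) cost′) cost)

  defect-zero⇒componentwiseRegular : ∀ {G} → Admissible G → defect G ≡ 0 → ComponentwiseRegular G
  defect-zero⇒componentwiseRegular {G} adm defect≡0 = regular-or-isolated⇒componentwiseRegular G Δ regular-or-isolated
    where
    regular-or-isolated : ∀ v → deg G v ≡ Δ ⊎ (∀ w → adj G v w ≡ false)
    regular-or-isolated v with frozen v in frozen-v
    ... | true  = inj₂ (frozen-isolated adm frozen-v)
    ... | false with near-regular adm frozen-v
    ...   | inj₁ deg≡Δ = inj₁ deg≡Δ
    ...   | inj₂ suc≡Δ =
      contradiction (subst (0 <_) defect≡0 (witness⇒count-pos (deficient? G) (frozen-v , suc≡Δ))) λ ()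

-- The odd case and the theorem

length-filter : ∀ {A : Set} {P : Pred A 0ℓ} (P? : Decidable P) xs →
                length (filter P? xs) ≡ sum (map (λ x → ind (does (P? x))) xs)
length-filter P? []       = refl
length-filter P? (x ∷ xs) with does (P? x)
... | true  = cong suc (length-filter P? xs)
... | false = length-filter P? xs

parity-clash : ∀ a b c d → 2 * a + 1 ≡ c * d → 2 * b + 1 + d ≡ c * d → ⊥
parity-clash a b c d odd odd′ = even≢odd (c * (a ∸ b)) a (begin
  2 * (c * (a ∸ b))  ≡⟨ swap-factors c (a ∸ b) ⟩
  c * (2 * (a ∸ b))  ≡⟨ cong (c *_) d-even ⟨
  c * d              ≡⟨ odd ⟨
  2 * a + 1          ≡⟨ +-comm (2 * a) 1 ⟩
  suc (2 * a)        ∎)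
  where
  open ≡-Reasoning
  swap-factors : ∀ c x → 2 * (c * x) ≡ c * (2 * x)
  swap-factors = solve-∀
  move-d : ∀ b d → 2 * b + d + 1 ≡ 2 * b + 1 + d
  move-d = solve-∀
  2b+d≡2a : 2 * b + d ≡ 2 * a
  2b+d≡2a = +-cancelʳ-≡ 1 (2 * b + d) (2 * a) (trans (move-d b d) (trans odd′ (sym odd)))
  d-even : d ≡ 2 * (a ∸ b)
  d-even = begin
    d                  ≡⟨ m+n∸m≡n (2 * b) d ⟨
    2 * b + d ∸ 2 * b  ≡⟨ cong (_∸ 2 * b) 2b+d≡2a ⟩
    2 * a ∸ 2 * b      ≡⟨ *-distribˡ-∸ 2 a b ⟨
    2 * (a ∸ b)        ∎

module _ {n : ℕ} (Δ : ℕ) (room : 1 ≤ Δ → 2 * Δ + 3 ≤ n) where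

  private
    unfrozen : Fin n → Bool
    unfrozen _ = false

    unfrozen-count : Σᵥ (ind ∘ unfrozen) ≡ 0
    unfrozen-count = Σᵥ-zero {n}

    unfrozen-few : Σᵥ (ind ∘ unfrozen) ≤ 1
    unfrozen-few = ≤-trans (≤-reflexive unfrozen-count) z≤n

    module R₀ = Repair Δ unfrozen room unfrozen-few
    module Rᵤ (u : Fin n) = Repair Δ (_≡ᵇ u) room (≤-reflexive (Σᵥ-indicator u))

  isolate-admissible : ∀ {G u} → R₀.Admissible G → R₀.defect G ≡ 1 → R₀.Deficient G u →
                       Rᵤ.Admissible u (isolate G u) × Rᵤ.defect u (isolate G u) ≤ deg G u
  isolate-admissible {G} {u} adm defect≡1 u-def =
    record { frozen-isolated = isolated ; near-regular = near-regular ∘ ≡ᵇ-false⇒≢ }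
    , count-mono (Rᵤ.deficient? u (isolate G u)) (adj G u) lost-neighbour
    where
    isolated : ∀ {v} → v ≡ᵇ u ≡ true → ∀ w → adj (isolate G u) v w ≡ false
    isolated {v} v≡ᵇu w with refl ← ≡ᵇ-true⇒≡ {i = v} {u} v≡ᵇu = isolate-isolated G u w
    full : ∀ {w} → w ≢ u → deg G w ≡ Δ
    full {w} w≢u with R₀.Admissible.near-regular adm {w} refl
    ... | inj₁ deg≡Δ = deg≡Δ
    ... | inj₂ suc≡Δ =
      contradiction (subst (2 ≤_) defect≡1 (count-pair (R₀.deficient? G) w≢u (refl , suc≡Δ) u-def)) λ { (s≤s ()) }
    near-regular : ∀ {w} → w ≢ u → deg (isolate G u) w ≡ Δ ⊎ suc (deg (isolate G u) w) ≡ Δ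
    near-regular {w} w≢u with adj G w u | deg-isolate G w≢u
    ... | true  | deg≡ = inj₂ (trans (+-comm 1 _) (trans deg≡ (full w≢u)))
    ... | false | deg≡ = inj₁ (trans (sym (+-identityʳ _)) (trans deg≡ (full w≢u)))
    lost-neighbour : ∀ {w} → Rᵤ.Deficient u (isolate G u) w → adj G u w ≡ true
    lost-neighbour {w} (w≢ᵇu , suc≡Δ′) = trans (Graph.sym G u w) (adjacent (≡ᵇ-false⇒≢ w≢ᵇu))
      where
      adjacent : w ≢ u → adj G w u ≡ true
      adjacent w≢u with adj G w u | deg-isolate G w≢u
      ... | true  | _    = refl
      ... | false | deg≡ = contradiction (trans suc≡Δ′ (sym (trans (sym (+-identityʳ _)) (trans deg≡ (full w≢u))))) 1+n≢n

  repair-odd : ∀ {G} → R₀.Admissible G → R₀.defect G ≡ 1 →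
               Σ (Graph n) λ H → ComponentwiseRegular H × dist G H ≤ 2 * (3 * Δ)
  repair-odd {G} adm defect≡1 with count-witness (R₀.deficient? G) (subst (0 <_) (sym defect≡1) (s≤s z≤n))
  ... | u , u-def with isolate-admissible adm defect≡1 u-def
  ...   | admᵤ , defect≤deg with Rᵤ.repair u _ admᵤ refl
  ...     | K , admK , inj₁ defect≡0 , cost =
    K , Rᵤ.defect-zero⇒componentwiseRegular u admK defect≡0 , bound
    where
    H : Graph n
    H = isolate G u
    deg≤Δ : deg G u ≤ Δ
    deg≤Δ = ≤-trans (n≤1+n _) (≤-reflexive (proj₂ u-def))
    bound : dist G K ≤ 2 * (3 * Δ)
    bound = begin
      dist G K                                   ≤⟨ dist-triangle G H K ⟩
      dist G H + dist H K                        ≤⟨ +-mono-≤ (dist-isolate G u) cost ⟩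
      2 * deg G u + 2 * Rᵤ.edits u (Rᵤ.defect u H)
        ≤⟨ +-mono-≤ (*-monoʳ-≤ 2 deg≤Δ)
                    (*-monoʳ-≤ 2 (≤-trans (Rᵤ.edits≤ u _) (+-monoˡ-≤ Δ (≤-trans defect≤deg deg≤Δ)))) ⟩
      2 * Δ + 2 * (Δ + Δ)                        ≡⟨ regroup Δ ⟩
      2 * (3 * Δ)                                ∎
      where
      open ≤-Reasoning
      regroup : ∀ d → 2 * d + 2 * (d + d) ≡ 2 * (3 * d)
      regroup = solve-∀
  -- Degree sums are even: the first run makes nΔ odd, and a second run ending at one
  -- deficient vertex would make Δ even.
  ...     | K , admK , inj₂ defect≡1′ , _ = ⊥-elim (parity-clash h₀ h₁ n Δ odd₀ odd₁)
    where
    h₀ h₁ : ℕ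
    h₀ = proj₁ (degreeSum-even G)
    h₁ = proj₁ (degreeSum-even K)
    odd₀ : 2 * h₀ + 1 ≡ n * Δ
    odd₀ = begin
      2 * h₀ + 1
        ≡⟨ cong₂ _+_ (proj₂ (degreeSum-even G)) defect≡1 ⟨
      Σᵥ (deg G) + R₀.defect G
        ≡⟨ +-identityʳ _ ⟨
      Σᵥ (deg G) + R₀.defect G + 0
        ≡⟨ cong (Σᵥ (deg G) + R₀.defect G +_) (trans (cong (Δ *_) unfrozen-count) (*-zeroʳ Δ)) ⟨
      Σᵥ (deg G) + R₀.defect G + Δ * Σᵥ (ind ∘ unfrozen)
        ≡⟨ R₀.degreeSum-defect adm ⟩
      n * Δ ∎
      where open ≡-Reasoning
    odd₁ : 2 * h₁ + 1 + Δ ≡ n * Δ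
    odd₁ = begin
      2 * h₁ + 1 + Δ
        ≡⟨ cong₂ (λ s c → s + c + Δ) (proj₂ (degreeSum-even K)) defect≡1′ ⟨
      Σᵥ (deg K) + Rᵤ.defect u K + Δ
        ≡⟨ cong (Σᵥ (deg K) + Rᵤ.defect u K +_) (trans (cong (Δ *_) (Σᵥ-indicator u)) (*-identityʳ Δ)) ⟨
      Σᵥ (deg K) + Rᵤ.defect u K + Δ * Σᵥ (λ v → ind (v ≡ᵇ u))
        ≡⟨ Rᵤ.degreeSum-defect u admK ⟩
      n * Δ ∎
      where open ≡-Reasoning

  nearRegular-repair : ∀ (G : Graph n) k → (∀ v → deg G v ≡ Δ ⊎ suc (deg G v) ≡ Δ) → numDegPred G Δ ≡ k →
                       Σ (Graph n) λ H → ComponentwiseRegular H × dist G H ≤ 2 * (k + 4 * Δ)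
  nearRegular-repair G k degrees count≡k
    with R₀.repair k admissible (trans (sym (length-filter _ (allFin n))) count≡k)
    where
    admissible : R₀.Admissible G
    admissible = record { frozen-isolated = λ () ; near-regular = λ {v} _ → degrees v }
  ... | H , admH , inj₁ defect≡0 , cost =
    H , R₀.defect-zero⇒componentwiseRegular admH defect≡0 , (begin
    dist G H         ≤⟨ cost ⟩
    2 * R₀.edits k   ≤⟨ *-monoʳ-≤ 2 (≤-trans (R₀.edits≤ k) (+-monoʳ-≤ k (m≤n*m Δ 4))) ⟩
    2 * (k + 4 * Δ)  ∎)
    where open ≤-Reasoning
  ... | H , admH , inj₂ defect≡1 , cost with repair-odd admH defect≡1
  ...   | K , regular , cost′ = K , regular , (begin
    dist G K                   ≤⟨ dist-triangle G H K ⟩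
    dist G H + dist H K        ≤⟨ +-mono-≤ (≤-trans cost (*-monoʳ-≤ 2 (R₀.edits≤ k))) cost′ ⟩
    2 * (k + Δ) + 2 * (3 * Δ)  ≡⟨ regroup k Δ ⟩
    2 * (k + 4 * Δ)            ∎)
    where
    open ≤-Reasoning
    regroup : ∀ k d → 2 * (k + d) + 2 * (3 * d) ≡ 2 * (k + 4 * d)
    regroup = solve-∀

room-from-size : ∀ n Δ → Δ + Δ ^ 2 + Δ ^ 3 + 2 ≤ n → 1 ≤ Δ → 2 * Δ + 3 ≤ n
room-from-size n (suc d) large _ = begin
  2 * suc d + 3                                          ≤⟨ m≤m+n _ _ ⟩
  2 * suc d + 3 + (d * d * d + 4 * (d * d) + 4 * d)      ≡⟨ expand d ⟩
  suc d + suc d ^ 2 + suc d ^ 3 + 2                      ≤⟨ large ⟩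
  n                                                      ∎
  where
  open ≤-Reasoning
  expand : ∀ d → 2 * (1 + d) + 3 + (d * d * d + 4 * (d * d) + 4 * d)
               ≡ (1 + d) + (1 + d) * ((1 + d) * 1) + (1 + d) * ((1 + d) * ((1 + d) * 1)) + 2
  expand = solve-∀

proposition4 : (n Δ k : ℕ) (G : Graph n)
    → (∀ v → deg G v ≡ Δ ⊎ suc (deg G v) ≡ Δ)
    → numDegPred G Δ ≡ k
    → (∀ v → suc (deg G v) ≡ Δ → IsSeparationVertex G v)
    → Δ + Δ ^ 2 + Δ ^ 3 + 2 ≤ n
    → Σ (Graph n) λ H → ComponentwiseRegular H × DistLE G H (k + 4 * Δ)
proposition4 n Δ k G degrees count≡k _ large
  with nearRegular-repair Δ (room-from-size n Δ large) G k degrees count≡k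
... | H , regular , dist≤ = H , regular , Perm.id , dist≤
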